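{- For all integers $m\ge1$ and $k\ge0$, and $|x|<1$, $$\mathrm{Hl}^m_{ -k}(x)=\sum_{j=1}^m\binom{m}{j}(-1)^{j+1}\left(\mathrm{Hl}^{m-j}_{j-k}(x)+\sum_{l=0}^k\binom{k}{l}\mathrm{Li}_{l-k}(x)\,\mathrm{Hl}^{m-j}_{j-l}(x)\right).$$
   Context: $H_n=1+\frac12+\cdots+\frac1n$. For integers $m\ge0$ and $s\in\mathbb{C}$, the harmonic polylogarithm is $\mathrm{Hl}^m_s(x)=\sum_{n\ge1}H_n^m n^{ -s}x^n$ ($|x|<1$); in particular $\mathrm{Hl}^0_s(x)=\mathrm{Li}_s(x)=\sum_{n\ge1}x^n n^{ -s}$ is the polylogarithm. -}

module Defs where

open import Data.Nat as ℕ using (ℕ; zero; suc)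
open import Data.Nat.Combinatorics using (_C_)
open import Data.Integer as ℤ using (ℤ; +_; -[1+_])
open import Data.Rational using (ℚ; _/_; 0ℚ; 1ℚ; _+_; _*_; -_)

-- Finite sum  Σ_{i = a}^{b} f i  (empty if b < a), written sumFromTo a b f.
sumFromTo : ℕ → ℕ → (ℕ → ℚ) → ℚ
sumFromTo a b f = go (suc b ℕ.∸ a)
  where
  go : ℕ → ℚ
  go zero = 0ℚ
  go (suc r) = go r + f (a ℕ.+ r)

ℕtoℚ : ℕ → ℚ
ℕtoℚ n = (+ n) / 1

_^ℚ_ : ℚ → ℕ → ℚ
q ^ℚ zero = 1ℚ
q ^ℚ suc n = q * (q ^ℚ n)

sign : ℕ → ℚ
sign n = (- 1ℚ) ^ℚ n

H : ℕ → ℚ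
H zero = 0ℚ
H (suc n) = H n + ((+ 1) / suc n)

-- (suc n) ^ (- s) for integer s
npowNeg : ℕ → ℤ → ℚ
npowNeg n (+ a) = ((+ 1) / suc n) ^ℚ a
npowNeg n -[1+ a ] = ℕtoℚ (suc n) ^ℚ suc a

-- Coefficient of x^n in the harmonic polylogarithm
--   Hl^m_s(x) = Σ_{n ≥ 1} H_n^m n^{-s} x^n   (s ∈ ℤ)
Hl : ℕ → ℤ → ℕ → ℚ
Hl m s zero = 0ℚ
Hl m s (suc n) = (H (suc n) ^ℚ m) * npowNeg n s

Li : ℤ → ℕ → ℚ
Li s = Hl 0 s

-- Cauchy product of power series (coefficient of x^N in f(x) g(x))
_⊛_ : (ℕ → ℚ) → (ℕ → ℚ) → ℕ → ℚ
(f ⊛ g) N = sumFromTo 0 N (λ i → f i * g (N ℕ.∸ i))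

-- coefficient of x^N in the right-hand side of Theorem 1.1
rhs : ℕ → ℕ → ℕ → ℚ
rhs m k N =
  sumFromTo 1 m (λ j →
    (ℕtoℚ (m C j) * sign (suc j)) *
    ( Hl (m ℕ.∸ j) (+ j ℤ.- + k) N
    + sumFromTo 0 k (λ l →
        ℕtoℚ (k C l) * ((Li (+ l ℤ.- + k) ⊛ Hl (m ℕ.∸ j) (+ j ℤ.- + l)) N))))

{-# OPTIONS --safe #-}
-- Compare coefficients of x^N.  For the backward difference ∇ of p ↦ H_p^m,
--   ∇(H^m)_p = H_p^m − (H_p − 1/p)^m = Σ_{j=1}^m C(m,j) (−1)^{j+1} H_p^{m−j} p^{−j},
-- so on the right-hand side every inner sum over j collapses to p^l ∇(H^m)_p.  On the left,
-- H_N^m N^k telescopes to Σ_{p ≤ N} ∇(H^m)_p N^k: the term p = N is the Hl^{m−j}_{j−k} part, and for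
-- p < N the expansion N^k = Σ_l C(k,l) p^l (N − p)^{k−l} produces the convolution with Li_{l−k},
-- whose n-th coefficient is n^{k−l}.
module Submission where

open import Defs
open import Data.Nat using (ℕ; _≥_)
open import Data.Integer using (-_; +_)
open import Relation.Binary.PropositionalEquality using (_≡_)

open import Algebra.Bundles using (CommutativeRing)
open import Data.Fin.Base using (Fin; toℕ)
open import Data.Fin.Properties using (toℕ<n; toℕ≤pred[n]; toℕ-inject₁; toℕ-fromℕ)
open import Data.Integer.Base as ℤ using (_⊖_)
import Data.Integer.Properties as ℤₚ
import Data.Integer.Solver as ℤ-Solver
open import Data.Nat.Base as ℕ using (zero; suc; _∸_)
open import Data.Nat.Combinatorics using (_C_)
import Data.Nat.Properties as ℕₚ
open import Data.Rational.Base as ℚ using (ℚ; 0ℚ; 1ℚ; _/_; _+_; _*_; _-_; toℚᵘ)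
import Data.Rational.Properties as ℚₚ
import Data.Rational.Solver as ℚ-Solver
open import Data.Rational.Unnormalised.Base as ℚᵘ using (mkℚᵘ; *≡*) renaming (_≃_ to _≃ᵘ_)
import Data.Rational.Unnormalised.Properties as ℚᵘₚ
open import Relation.Binary.PropositionalEquality
  using (refl; sym; trans; cong; cong₂; module ≡-Reasoning)

open CommutativeRing ℚₚ.+-*-commutativeRing
  using (semiring; commutativeSemiring; *-commutativeSemigroup)
open import Algebra.Properties.CommutativeSemigroup *-commutativeSemigroup using (x∙yz≈y∙xz)
open import Algebra.Properties.CommutativeSemiring.Binomial commutativeSemiring using (theorem)
open import Algebra.Properties.Semiring.Exp semiring using (_^_)
open import Algebra.Properties.Semiring.Mult semiring using (_×_)
open import Algebra.Properties.Semiring.Sum semiring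
  using (sum-syntax; sum⁺-syntax; sum-cong-≗; sum-init-last; sum-replicate-zero;
         ∑-distrib-+; ∑-comm; *-distribˡ-sum; *-distribʳ-sum)

toℚᵘ-ℕtoℚ : ∀ n → toℚᵘ (ℕtoℚ n) ≃ᵘ mkℚᵘ (+ n) 0
toℚᵘ-ℕtoℚ n = ℚₚ.toℚᵘ-fromℚᵘ (mkℚᵘ (+ n) 0)

ℕtoℚ-suc : ∀ n → ℕtoℚ (suc n) ≡ 1ℚ + ℕtoℚ n
ℕtoℚ-suc n = ℚₚ.toℚᵘ-injective (begin
  toℚᵘ (ℕtoℚ (suc n))         ≈⟨ toℚᵘ-ℕtoℚ (suc n) ⟩
  mkℚᵘ (+ suc n) 0            ≈⟨ *≡* (solve 1 (λ x → (con (+ 1) :+ x) :* con (+ 1)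
                                   := (con (+ 1) :* con (+ 1) :+ x :* con (+ 1)) :* con (+ 1)) refl (+ n)) ⟩
  toℚᵘ 1ℚ ℚᵘ.+ mkℚᵘ (+ n) 0   ≈⟨ ℚᵘₚ.+-congʳ (toℚᵘ 1ℚ) (toℚᵘ-ℕtoℚ n) ⟨
  toℚᵘ 1ℚ ℚᵘ.+ toℚᵘ (ℕtoℚ n)  ≈⟨ ℚₚ.toℚᵘ-homo-+ 1ℚ (ℕtoℚ n) ⟨
  toℚᵘ (1ℚ + ℕtoℚ n)          ∎)
  where
  open ℚᵘₚ.≃-Reasoning
  open ℤ-Solver.+-*-Solver

1/[1+n]*[1+n]≡1 : ∀ n → ((+ 1) / suc n) * ℕtoℚ (suc n) ≡ 1ℚ
1/[1+n]*[1+n]≡1 n = ℚₚ.toℚᵘ-injective (begin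
  toℚᵘ ((+ 1) / suc n * ℕtoℚ (suc n))            ≈⟨ ℚₚ.toℚᵘ-homo-* ((+ 1) / suc n) (ℕtoℚ (suc n)) ⟩
  toℚᵘ ((+ 1) / suc n) ℚᵘ.* toℚᵘ (ℕtoℚ (suc n))  ≈⟨ ℚᵘₚ.*-cong (ℚₚ.toℚᵘ-fromℚᵘ (mkℚᵘ (+ 1) n))
                                                                (toℚᵘ-ℕtoℚ (suc n)) ⟩
  mkℚᵘ (+ 1) n ℚᵘ.* mkℚᵘ (+ suc n) 0             ≈⟨ *≡* (solve 1 (λ x → (con (+ 1) :* (con (+ 1) :+ x)) :* con (+ 1)
                                                      := con (+ 1) :* ((con (+ 1) :+ x) :* con (+ 1))) refl (+ n)) ⟩
  toℚᵘ 1ℚ                                         ∎)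
  where
  open ℚᵘₚ.≃-Reasoning
  open ℤ-Solver.+-*-Solver

ℕtoℚ-homo-+ : ∀ a b → ℕtoℚ (a ℕ.+ b) ≡ ℕtoℚ a + ℕtoℚ b
ℕtoℚ-homo-+ zero    b = sym (ℚₚ.+-identityˡ (ℕtoℚ b))
ℕtoℚ-homo-+ (suc a) b = begin
  ℕtoℚ (suc (a ℕ.+ b))          ≡⟨ ℕtoℚ-suc (a ℕ.+ b) ⟩
  1ℚ + ℕtoℚ (a ℕ.+ b)           ≡⟨ cong (λ q → 1ℚ + q) (ℕtoℚ-homo-+ a b) ⟩
  1ℚ + (ℕtoℚ a + ℕtoℚ b)        ≡⟨ ℚₚ.+-assoc 1ℚ (ℕtoℚ a) (ℕtoℚ b) ⟨
  1ℚ + ℕtoℚ a + ℕtoℚ b          ≡⟨ cong (_+ ℕtoℚ b) (ℕtoℚ-suc a) ⟨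
  ℕtoℚ (suc a) + ℕtoℚ b         ∎
  where open ≡-Reasoning

ℕtoℚ-*≡× : ∀ n x → ℕtoℚ n * x ≡ n × x
ℕtoℚ-*≡× zero    x = ℚₚ.*-zeroˡ x
ℕtoℚ-*≡× (suc n) x = begin
  ℕtoℚ (suc n) * x         ≡⟨ cong (_* x) (ℕtoℚ-suc n) ⟩
  (1ℚ + ℕtoℚ n) * x        ≡⟨ ℚₚ.*-distribʳ-+ x 1ℚ (ℕtoℚ n) ⟩
  1ℚ * x + ℕtoℚ n * x      ≡⟨ cong₂ _+_ (ℚₚ.*-identityˡ x) (ℕtoℚ-*≡× n x) ⟩
  x + n × x                ∎
  where open ≡-Reasoning

^ℚ≡^ : ∀ x n → x ^ℚ n ≡ x ^ n
^ℚ≡^ x zero    = refl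
^ℚ≡^ x (suc n) = cong (x *_) (^ℚ≡^ x n)

neg-^ℚ : ∀ x n → (ℚ.- x) ^ℚ n ≡ sign n * x ^ℚ n
neg-^ℚ x zero    = sym (ℚₚ.*-identityˡ 1ℚ)
neg-^ℚ x (suc n) = trans (cong (ℚ.- x *_) (neg-^ℚ x n)) (regroup x (sign n) (x ^ℚ n))
  where
  open ℚ-Solver.+-*-Solver
  regroup : ∀ x s y → ℚ.- x * (s * y) ≡ ℚ.- 1ℚ * s * (x * y)
  regroup = solve 3 (λ x s y → :- x :* (s :* y) := (:- con 1ℚ) :* s :* (x :* y)) refl

binomial : ∀ x y n →
  (x + y) ^ℚ n ≡ ∑[ j ≤ n ] (ℕtoℚ (n C toℕ j) * (x ^ℚ toℕ j * y ^ℚ (n ∸ toℕ j)))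
binomial x y n = begin
  (x + y) ^ℚ n   ≡⟨ ^ℚ≡^ (x + y) n ⟩
  (x + y) ^ n    ≡⟨ theorem n x y ⟩
  ∑[ j ≤ n ] ((n C toℕ j) × (x ^ toℕ j * y ^ (n ∸ toℕ j)))
    ≡⟨ sum-cong-≗ {suc n} (λ j → sym (trans
         (cong₂ (λ a b → ℕtoℚ (n C toℕ j) * (a * b)) (^ℚ≡^ x (toℕ j)) (^ℚ≡^ y (n ∸ toℕ j)))
         (ℕtoℚ-*≡× (n C toℕ j) _))) ⟩
  ∑[ j ≤ n ] (ℕtoℚ (n C toℕ j) * (x ^ℚ toℕ j * y ^ℚ (n ∸ toℕ j))) ∎
  where open ≡-Reasoning

∑-init-last : ∀ n (f : ℕ → ℚ) → ∑[ i < suc n ] f (toℕ i) ≡ ∑[ i < n ] f (toℕ i) + f n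
∑-init-last n f = trans (sum-init-last {n} (λ i → f (toℕ i)))
  (cong₂ _+_ (sum-cong-≗ {n} (λ i → cong f (toℕ-inject₁ i))) (cong f (toℕ-fromℕ n)))

sumFromTo0≡∑ : ∀ b f → sumFromTo 0 b f ≡ ∑[ i ≤ b ] f (toℕ i)
sumFromTo0≡∑ zero    f = sym (∑-init-last 0 f)
sumFromTo0≡∑ (suc b) f = trans (cong (_+ f (suc b)) (sumFromTo0≡∑ b f)) (sym (∑-init-last (suc b) f))

sumFromTo1≡∑ : ∀ b f → sumFromTo 1 b f ≡ ∑[ i < b ] f (suc (toℕ i))
sumFromTo1≡∑ zero    f = refl
sumFromTo1≡∑ (suc b) f =
  trans (cong (_+ f (suc b)) (sumFromTo1≡∑ b f)) (sym (∑-init-last b (λ i → f (suc i))))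

∑-*-∑-comm : ∀ {m n} (a : Fin m → ℚ) (b : Fin n → ℚ) (X : Fin m → Fin n → ℚ) →
  ∑[ j < m ] (a j * ∑[ l < n ] (b l * X j l)) ≡ ∑[ l < n ] (b l * ∑[ j < m ] (a j * X j l))
∑-*-∑-comm {m} {n} a b X = begin
  ∑[ j < m ] (a j * ∑[ l < n ] (b l * X j l))
    ≡⟨ sum-cong-≗ {m} (λ j → *-distribˡ-sum {n} (a j) _) ⟩
  ∑[ j < m ] ∑[ l < n ] (a j * (b l * X j l))
    ≡⟨ sum-cong-≗ {m} (λ j → sum-cong-≗ {n} (λ l → x∙yz≈y∙xz (a j) (b l) (X j l))) ⟩
  ∑[ j < m ] ∑[ l < n ] (b l * (a j * X j l))
    ≡⟨ ∑-comm {m} {n} (λ j l → b l * (a j * X j l)) ⟩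
  ∑[ l < n ] ∑[ j < m ] (b l * (a j * X j l))
    ≡⟨ sum-cong-≗ {n} (λ l → *-distribˡ-sum {m} (b l) _) ⟨
  ∑[ l < n ] (b l * ∑[ j < m ] (a j * X j l)) ∎
  where open ≡-Reasoning

⊛≡∑ : ∀ f g N → (f ⊛ g) N ≡ ∑[ i ≤ N ] (f (toℕ i) * g (N ∸ toℕ i))
⊛≡∑ f g N = sumFromTo0≡∑ N (λ i → f i * g (N ∸ i))

⊛-congʳ : ∀ f {g g′} → (∀ q → g q ≡ g′ q) → ∀ N → (f ⊛ g) N ≡ (f ⊛ g′) N
⊛-congʳ f {g} {g′} g≗g′ N = trans (⊛≡∑ f g N)
  (trans (sum-cong-≗ {suc N} (λ i → cong (f (toℕ i) *_) (g≗g′ (N ∸ toℕ i)))) (sym (⊛≡∑ f g′ N)))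

⊛-linearʳ : ∀ {m} (a : Fin m → ℚ) f (g : Fin m → ℕ → ℚ) N →
  ∑[ j < m ] (a j * (f ⊛ g j) N) ≡ (f ⊛ λ q → ∑[ j < m ] (a j * g j q)) N
⊛-linearʳ {m} a f g N = begin
  ∑[ j < m ] (a j * (f ⊛ g j) N)
    ≡⟨ sum-cong-≗ {m} (λ j → cong (a j *_) (⊛≡∑ f (g j) N)) ⟩
  ∑[ j < m ] (a j * ∑[ i ≤ N ] (f (toℕ i) * g j (N ∸ toℕ i)))
    ≡⟨ ∑-*-∑-comm {m} {suc N} a (λ i → f (toℕ i)) (λ j i → g j (N ∸ toℕ i)) ⟩
  ∑[ i ≤ N ] (f (toℕ i) * ∑[ j < m ] (a j * g j (N ∸ toℕ i)))
    ≡⟨ ⊛≡∑ f (λ q → ∑[ j < m ] (a j * g j q)) N ⟨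
  (f ⊛ λ q → ∑[ j < m ] (a j * g j q)) N ∎
  where open ≡-Reasoning

⊛≡∑-drop-0 : ∀ f g N → f 0 ≡ 0ℚ →
  (f ⊛ g) N ≡ ∑[ i < N ] (f (suc (toℕ i)) * g (N ∸ suc (toℕ i)))
⊛≡∑-drop-0 f g N f0≡0 = begin
  (f ⊛ g) N                    ≡⟨ ⊛≡∑ f g N ⟩
  f 0 * g N + tail             ≡⟨ cong (λ z → z * g N + tail) f0≡0 ⟩
  0ℚ * g N + tail              ≡⟨ cong (_+ tail) (ℚₚ.*-zeroˡ (g N)) ⟩
  0ℚ + tail                    ≡⟨ ℚₚ.+-identityˡ tail ⟩
  tail                         ∎
  where
  open ≡-Reasoning
  tail = ∑[ i < N ] (f (suc (toℕ i)) * g (N ∸ suc (toℕ i)))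

∇ : (ℕ → ℚ) → ℕ → ℚ
∇ g zero    = g zero
∇ g (suc n) = g (suc n) - g n

-- Summing in reverse order makes splitting off the top term p = N definitional.
∑-∇ : ∀ g N → ∑[ i ≤ N ] ∇ g (N ∸ toℕ i) ≡ g N
∑-∇ g zero    = ℚₚ.+-identityʳ (g 0)
∑-∇ g (suc N) = begin
  ∇ g (suc N) + ∑[ i ≤ N ] ∇ g (N ∸ toℕ i)   ≡⟨ cong (λ s → ∇ g (suc N) + s) (∑-∇ g N) ⟩
  g (suc N) - g N + g N                       ≡⟨ solve 2 (λ a b → a :- b :+ b := a) refl (g (suc N)) (g N) ⟩
  g (suc N)                                   ∎
  where
  open ≡-Reasoning
  open ℚ-Solver.+-*-Solver

npowNeg-⊖ : ∀ n a b → npowNeg n (a ⊖ b) ≡ ((+ 1) / suc n) ^ℚ a * ℕtoℚ (suc n) ^ℚ b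
npowNeg-⊖ n a       zero    = trans (cong (npowNeg n) (ℤₚ.⊖-≥ {a} ℕ.z≤n)) (sym (ℚₚ.*-identityʳ _))
npowNeg-⊖ n zero    (suc b) = sym (ℚₚ.*-identityˡ _)
npowNeg-⊖ n (suc a) (suc b) = begin
  npowNeg n (suc a ⊖ suc b)          ≡⟨ cong (npowNeg n) (ℤₚ.[1+m]⊖[1+n]≡m⊖n a b) ⟩
  npowNeg n (a ⊖ b)                  ≡⟨ npowNeg-⊖ n a b ⟩
  u ^ℚ a * s ^ℚ b                    ≡⟨ ℚₚ.*-identityˡ _ ⟨
  1ℚ * (u ^ℚ a * s ^ℚ b)             ≡⟨ cong (_* (u ^ℚ a * s ^ℚ b)) (1/[1+n]*[1+n]≡1 n) ⟨
  u * s * (u ^ℚ a * s ^ℚ b)          ≡⟨ solve 4 (λ u s x y → u :* s :* (x :* y) := u :* x :* (s :* y))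
                                          refl u s (u ^ℚ a) (s ^ℚ b) ⟩
  u * u ^ℚ a * (s * s ^ℚ b)          ∎
  where
  open ≡-Reasoning
  open ℚ-Solver.+-*-Solver
  u = (+ 1) / suc n
  s = ℕtoℚ (suc n)

npowNeg-neg : ∀ n k → npowNeg n (- (+ k)) ≡ ℕtoℚ (suc n) ^ℚ k
npowNeg-neg n zero    = refl
npowNeg-neg n (suc k) = refl

Hl-neg : ∀ m k N → m ≥ 1 → Hl m (- (+ k)) N ≡ H N ^ℚ m * ℕtoℚ N ^ℚ k
Hl-neg (suc m) k zero    _ = sym (trans (cong (_* ℕtoℚ 0 ^ℚ k) (ℚₚ.*-zeroˡ (H 0 ^ℚ m)))
                                        (ℚₚ.*-zeroˡ (ℕtoℚ 0 ^ℚ k)))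
Hl-neg m       k (suc n) _ = cong (H (suc n) ^ℚ m *_) (npowNeg-neg n k)

Li-neg : ∀ l k r → l ℕ.≤ k → Li (+ l ℤ.- + k) (suc r) ≡ ℕtoℚ (suc r) ^ℚ (k ∸ l)
Li-neg l k r l≤k = begin
  1ℚ * npowNeg r (+ l ℤ.- + k)      ≡⟨ ℚₚ.*-identityˡ _ ⟩
  npowNeg r (+ l ℤ.- + k)           ≡⟨ cong (npowNeg r) (trans (ℤₚ.m-n≡m⊖n l k) (ℤₚ.⊖-≤ l≤k)) ⟩
  npowNeg r (- (+ (k ∸ l)))         ≡⟨ npowNeg-neg r (k ∸ l) ⟩
  ℕtoℚ (suc r) ^ℚ (k ∸ l)           ∎
  where open ≡-Reasoning

altBinom : ℕ → ℕ → ℚ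
altBinom m j = ℕtoℚ (m C j) * sign (suc j)

^ℚ-backward-difference : ∀ x y m → y ^ℚ m - (y - x) ^ℚ m
  ≡ ∑[ j < m ] (altBinom m (suc (toℕ j)) * (y ^ℚ (m ∸ suc (toℕ j)) * x ^ℚ suc (toℕ j)))
^ℚ-backward-difference x y m = begin
  y ^ℚ m - (y - x) ^ℚ m
    ≡⟨ cong (λ z → y ^ℚ m - z ^ℚ m) (ℚₚ.+-comm y (ℚ.- x)) ⟩
  y ^ℚ m - (ℚ.- x + y) ^ℚ m
    ≡⟨ cong (λ z → y ^ℚ m - z) (binomial (ℚ.- x) y m) ⟩
  y ^ℚ m - (1ℚ * (1ℚ * y ^ℚ m) + ∑[ j < m ] T (suc (toℕ j)))
    ≡⟨ solve 2 (λ a b → a :- (con 1ℚ :* (con 1ℚ :* a) :+ b) := (:- con 1ℚ) :* b) refl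
         (y ^ℚ m) (∑[ j < m ] T (suc (toℕ j))) ⟩
  ℚ.- 1ℚ * ∑[ j < m ] T (suc (toℕ j))
    ≡⟨ *-distribˡ-sum {m} (ℚ.- 1ℚ) _ ⟩
  ∑[ j < m ] (ℚ.- 1ℚ * T (suc (toℕ j)))
    ≡⟨ sum-cong-≗ {m} (λ j → term (toℕ j)) ⟩
  ∑[ j < m ] (altBinom m (suc (toℕ j)) * (y ^ℚ (m ∸ suc (toℕ j)) * x ^ℚ suc (toℕ j))) ∎
  where
  open ≡-Reasoning
  open ℚ-Solver.+-*-Solver
  T : ℕ → ℚ
  T j = ℕtoℚ (m C j) * ((ℚ.- x) ^ℚ j * y ^ℚ (m ∸ j))
  term : ∀ j → ℚ.- 1ℚ * T (suc j) ≡ altBinom m (suc j) * (y ^ℚ (m ∸ suc j) * x ^ℚ suc j)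
  term j = trans (cong (λ z → ℚ.- 1ℚ * (ℕtoℚ (m C suc j) * (z * y ^ℚ (m ∸ suc j)))) (neg-^ℚ x (suc j)))
    (solve 4 (λ c s a b → :- con 1ℚ :* (c :* (s :* b :* a)) := c :* (:- con 1ℚ :* s) :* (a :* b)) refl
       (ℕtoℚ (m C suc j)) (sign (suc j)) (y ^ℚ (m ∸ suc j)) (x ^ℚ suc j))

∇Hpow : ℕ → ℕ → ℚ
∇Hpow m = ∇ (λ p → H p ^ℚ m)

∇Hpow-suc : ∀ m q → ∇Hpow m (suc q) ≡
  ∑[ j < m ] (altBinom m (suc (toℕ j)) * (H (suc q) ^ℚ (m ∸ suc (toℕ j)) * ((+ 1) / suc q) ^ℚ suc (toℕ j)))
∇Hpow-suc m q = trans (cong (λ z → H (suc q) ^ℚ m - z ^ℚ m) H-pred) (^ℚ-backward-difference ((+ 1) / suc q) (H (suc q)) m)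
  where
  open ℚ-Solver.+-*-Solver
  H-pred : H q ≡ H (suc q) - (+ 1) / suc q
  H-pred = solve 2 (λ a b → a := a :+ b :- b) refl (H q) ((+ 1) / suc q)

weighted∇Hpow : ℕ → ℕ → ℕ → ℚ
weighted∇Hpow m l q = ℕtoℚ q ^ℚ l * ∇Hpow m q

∑-altBinom-Hl≡weighted∇Hpow : ∀ m → m ≥ 1 → ∀ l q →
  ∑[ j < m ] (altBinom m (suc (toℕ j)) * Hl (m ∸ suc (toℕ j)) (+ suc (toℕ j) ℤ.- + l) q) ≡ weighted∇Hpow m l q
∑-altBinom-Hl≡weighted∇Hpow (suc m) _ l zero = begin
  ∑[ j < suc m ] (altBinom (suc m) (suc (toℕ j)) * 0ℚ)  ≡⟨ sum-cong-≗ {suc m} (λ j → ℚₚ.*-zeroʳ (altBinom (suc m) (suc (toℕ j)))) ⟩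
  ∑[ j < suc m ] 0ℚ                                      ≡⟨ sum-replicate-zero (suc m) ⟩
  0ℚ                                                     ≡⟨ ℚₚ.*-zeroʳ (ℕtoℚ 0 ^ℚ l) ⟨
  ℕtoℚ 0 ^ℚ l * 0ℚ                                       ≡⟨ cong (ℕtoℚ 0 ^ℚ l *_) (ℚₚ.*-zeroˡ (H 0 ^ℚ m)) ⟨
  weighted∇Hpow (suc m) l 0                              ∎
  where open ≡-Reasoning
∑-altBinom-Hl≡weighted∇Hpow m _ l (suc q) = begin
  ∑[ j < m ] (c j * (H (suc q) ^ℚ (m ∸ suc (toℕ j)) * npowNeg q (+ suc (toℕ j) ℤ.- + l)))
    ≡⟨ sum-cong-≗ {m} (λ j → regroup j) ⟩
  ∑[ j < m ] (s ^ℚ l * (c j * (H (suc q) ^ℚ (m ∸ suc (toℕ j)) * u ^ℚ suc (toℕ j))))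
    ≡⟨ *-distribˡ-sum {m} (s ^ℚ l) _ ⟨
  s ^ℚ l * ∑[ j < m ] (c j * (H (suc q) ^ℚ (m ∸ suc (toℕ j)) * u ^ℚ suc (toℕ j)))
    ≡⟨ cong (s ^ℚ l *_) (∇Hpow-suc m q) ⟨
  weighted∇Hpow m l (suc q) ∎
  where
  open ≡-Reasoning
  open ℚ-Solver.+-*-Solver
  c : Fin m → ℚ
  c j = altBinom m (suc (toℕ j))
  u = (+ 1) / suc q
  s = ℕtoℚ (suc q)
  regroup : ∀ j → c j * (H (suc q) ^ℚ (m ∸ suc (toℕ j)) * npowNeg q (+ suc (toℕ j) ℤ.- + l))
                ≡ s ^ℚ l * (c j * (H (suc q) ^ℚ (m ∸ suc (toℕ j)) * u ^ℚ suc (toℕ j)))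
  regroup j = trans
    (cong (λ z → c j * (H (suc q) ^ℚ (m ∸ suc (toℕ j)) * z))
          (trans (cong (npowNeg q) (ℤₚ.m-n≡m⊖n (suc (toℕ j)) l)) (npowNeg-⊖ q (suc (toℕ j)) l)))
    (solve 4 (λ c h a b → c :* (h :* (a :* b)) := b :* (c :* (h :* a))) refl
       (c j) (H (suc q) ^ℚ (m ∸ suc (toℕ j))) (u ^ℚ suc (toℕ j)) (s ^ℚ l))

∇Hpow-*-pow : ∀ m k q r → ∇Hpow m q * ℕtoℚ (q ℕ.+ suc r) ^ℚ k ≡
  ∑[ l ≤ k ] (ℕtoℚ (k C toℕ l) * (Li (+ toℕ l ℤ.- + k) (suc r) * weighted∇Hpow m (toℕ l) q))
∇Hpow-*-pow m k q r = begin
  d * ℕtoℚ (q ℕ.+ suc r) ^ℚ k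
    ≡⟨ cong (λ z → d * z ^ℚ k) (ℕtoℚ-homo-+ q (suc r)) ⟩
  d * (ℕtoℚ q + s) ^ℚ k
    ≡⟨ cong (d *_) (binomial (ℕtoℚ q) s k) ⟩
  d * ∑[ l ≤ k ] T l
    ≡⟨ *-distribˡ-sum {suc k} d T ⟩
  ∑[ l ≤ k ] (d * T l)
    ≡⟨ sum-cong-≗ {suc k} term ⟩
  ∑[ l ≤ k ] (κ l * (Li (+ toℕ l ℤ.- + k) (suc r) * weighted∇Hpow m (toℕ l) q)) ∎
  where
  open ≡-Reasoning
  open ℚ-Solver.+-*-Solver
  d = ∇Hpow m q
  s = ℕtoℚ (suc r)
  κ : Fin (suc k) → ℚ
  κ l = ℕtoℚ (k C toℕ l)
  T : Fin (suc k) → ℚ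
  T l = κ l * (ℕtoℚ q ^ℚ toℕ l * s ^ℚ (k ∸ toℕ l))
  term : ∀ l → d * T l ≡ κ l * (Li (+ toℕ l ℤ.- + k) (suc r) * weighted∇Hpow m (toℕ l) q)
  term l = trans
    (solve 4 (λ d c a b → d :* (c :* (a :* b)) := c :* (b :* (a :* d))) refl
       d (κ l) (ℕtoℚ q ^ℚ toℕ l) (s ^ℚ (k ∸ toℕ l)))
    (cong (λ z → κ l * (z * weighted∇Hpow m (toℕ l) q)) (sym (Li-neg (toℕ l) k r (toℕ≤pred[n] l))))

∑-∇Hpow-*-pow : ∀ m k N → ∑[ i < N ] (∇Hpow m (N ∸ suc (toℕ i)) * ℕtoℚ N ^ℚ k) ≡
  ∑[ l ≤ k ] (ℕtoℚ (k C toℕ l) * (Li (+ toℕ l ℤ.- + k) ⊛ weighted∇Hpow m (toℕ l)) N)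
∑-∇Hpow-*-pow m k N = begin
  ∑[ i < N ] (∇Hpow m (N ∸ suc (toℕ i)) * ℕtoℚ N ^ℚ k)
    ≡⟨ sum-cong-≗ {N} split ⟩
  ∑[ i < N ] ∑[ l ≤ k ] (κ l * (L l (suc (toℕ i)) * W l (N ∸ suc (toℕ i))))
    ≡⟨ ∑-comm {N} {suc k} (λ i l → κ l * (L l (suc (toℕ i)) * W l (N ∸ suc (toℕ i)))) ⟩
  ∑[ l ≤ k ] ∑[ i < N ] (κ l * (L l (suc (toℕ i)) * W l (N ∸ suc (toℕ i))))
    ≡⟨ sum-cong-≗ {suc k} (λ l → trans (sym (*-distribˡ-sum {N} (κ l) _))
         (cong (κ l *_) (sym (⊛≡∑-drop-0 (L l) (W l) N refl)))) ⟩
  ∑[ l ≤ k ] (κ l * (L l ⊛ W l) N) ∎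
  where
  open ≡-Reasoning
  κ : Fin (suc k) → ℚ
  κ l = ℕtoℚ (k C toℕ l)
  L : Fin (suc k) → ℕ → ℚ
  L l = Li (+ toℕ l ℤ.- + k)
  W : Fin (suc k) → ℕ → ℚ
  W l = weighted∇Hpow m (toℕ l)
  split : ∀ i → ∇Hpow m (N ∸ suc (toℕ i)) * ℕtoℚ N ^ℚ k
              ≡ ∑[ l ≤ k ] (κ l * (L l (suc (toℕ i)) * W l (N ∸ suc (toℕ i))))
  split i = trans (cong (λ n → ∇Hpow m (N ∸ suc (toℕ i)) * ℕtoℚ n ^ℚ k) (sym (ℕₚ.m∸n+n≡m (toℕ<n i))))
                  (∇Hpow-*-pow m k (N ∸ suc (toℕ i)) (toℕ i))

collapsedRhs : ℕ → ℕ → ℕ → ℚ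
collapsedRhs m k N = weighted∇Hpow m k N +
  ∑[ l ≤ k ] (ℕtoℚ (k C toℕ l) * (Li (+ toℕ l ℤ.- + k) ⊛ weighted∇Hpow m (toℕ l)) N)

Hpow-*-pow≡collapsedRhs : ∀ m k N → H N ^ℚ m * ℕtoℚ N ^ℚ k ≡ collapsedRhs m k N
Hpow-*-pow≡collapsedRhs m k N = begin
  H N ^ℚ m * P
    ≡⟨ cong (_* P) (∑-∇ (λ p → H p ^ℚ m) N) ⟨
  (∇Hpow m N + ∑[ i < N ] ∇Hpow m (N ∸ suc (toℕ i))) * P
    ≡⟨ ℚₚ.*-distribʳ-+ P (∇Hpow m N) _ ⟩
  ∇Hpow m N * P + (∑[ i < N ] ∇Hpow m (N ∸ suc (toℕ i))) * P
    ≡⟨ cong₂ _+_ (ℚₚ.*-comm (∇Hpow m N) P) (*-distribʳ-sum {N} P (λ i → ∇Hpow m (N ∸ suc (toℕ i)))) ⟩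
  weighted∇Hpow m k N + ∑[ i < N ] (∇Hpow m (N ∸ suc (toℕ i)) * P)
    ≡⟨ cong (λ z → weighted∇Hpow m k N + z) (∑-∇Hpow-*-pow m k N) ⟩
  collapsedRhs m k N ∎
  where
  open ≡-Reasoning
  P = ℕtoℚ N ^ℚ k

rhs≡collapsedRhs : ∀ m k N → m ≥ 1 → rhs m k N ≡ collapsedRhs m k N
rhs≡collapsedRhs m k N m≥1 = begin
  rhs m k N
    ≡⟨ sumFromTo1≡∑ m _ ⟩
  ∑[ j < m ] (c j * (G j k N + sumFromTo 0 k (λ l → κ l * (L l ⊛ G j l) N)))
    ≡⟨ sum-cong-≗ {m} (λ j → trans (cong (λ z → c j * (G j k N + z)) (sumFromTo0≡∑ k _))
                                   (ℚₚ.*-distribˡ-+ (c j) _ _)) ⟩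
  ∑[ j < m ] (c j * G j k N + c j * ∑[ l ≤ k ] (κ (toℕ l) * (L (toℕ l) ⊛ G j (toℕ l)) N))
    ≡⟨ ∑-distrib-+ {m} (λ j → c j * G j k N) _ ⟩
  ∑[ j < m ] (c j * G j k N) + ∑[ j < m ] (c j * ∑[ l ≤ k ] (κ (toℕ l) * (L (toℕ l) ⊛ G j (toℕ l)) N))
    ≡⟨ cong₂ _+_ (∑-altBinom-Hl≡weighted∇Hpow m m≥1 k N)
                 (∑-*-∑-comm {m} {suc k} c (λ l → κ (toℕ l)) (λ j l → (L (toℕ l) ⊛ G j (toℕ l)) N)) ⟩
  weighted∇Hpow m k N + ∑[ l ≤ k ] (κ (toℕ l) * ∑[ j < m ] (c j * (L (toℕ l) ⊛ G j (toℕ l)) N))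
    ≡⟨ cong (λ z → weighted∇Hpow m k N + z) (sum-cong-≗ {suc k} (λ l → cong (κ (toℕ l) *_)
         (trans (⊛-linearʳ c (L (toℕ l)) (λ j → G j (toℕ l)) N)
                (⊛-congʳ (L (toℕ l)) (∑-altBinom-Hl≡weighted∇Hpow m m≥1 (toℕ l)) N)))) ⟩
  collapsedRhs m k N ∎
  where
  open ≡-Reasoning
  c : Fin m → ℚ
  c j = altBinom m (suc (toℕ j))
  G : Fin m → ℕ → ℕ → ℚ
  G j l = Hl (m ∸ suc (toℕ j)) (+ suc (toℕ j) ℤ.- + l)
  κ : ℕ → ℚ
  κ l = ℕtoℚ (k C l)
  L : ℕ → ℕ → ℚ
  L l = Li (+ l ℤ.- + k)

theorem11 : (m k : ℕ) → m ≥ 1 → (N : ℕ) → Hl m (- (+ k)) N ≡ rhs m k N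
theorem11 m k m≥1 N = begin
  Hl m (- (+ k)) N         ≡⟨ Hl-neg m k N m≥1 ⟩
  H N ^ℚ m * ℕtoℚ N ^ℚ k   ≡⟨ Hpow-*-pow≡collapsedRhs m k N ⟩
  collapsedRhs m k N       ≡⟨ rhs≡collapsedRhs m k N m≥1 ⟨
  rhs m k N                ∎
  where open ≡-Reasoning
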